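{- Let $(G,t)$ be a rooted graph with $G$ biconnected. Let $f$ be a separating link of $G$ and let $e\neq f$ be a link of $G$. Then $f$ is separating in $G\setminus e$. Moreover, if $e$ is separating in $G\setminus f$, then $e$ is also separating in $G$, and the set $S'_e$ of links separated from $t$ by $e$ in $G\setminus f$ satisfies $S'_e=S_e\setminus\{f\}$, where $S_e$ is the corresponding set in $G$.
   Context: Graphs are finite, simple, undirected; $t$ is a designated root node. Biconnected: connected with no cut node. A link $\{u,v\}$ is separating if $G-\{u,v\}$ (removing both nodes) is disconnected. A separating link $\{u,v\}$ separates a node $w\notin\{u,v\}$ from $t$ if $w$ and $t$ lie in different components of $G-\{u,v\}$; it separates a link $g\neq\{u,v\}$ from $t$ if it separates at least one endpoint of $g$ from $t$. For a separating link $e$ not incident to $t$, $S_e$ is the set of links separated from $t$ by $e$; for a separating link incident to $t$ or a non-separating link, $S_e=\emptyset$. $G\setminus e$ removes the link $e$ only. -}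

module Defs where

open import Data.Nat using (ℕ)
open import Data.Fin using (Fin; _≟_)
open import Data.Bool using (Bool; true; false; _∧_; not; _∨_)
open import Data.Product using (_×_; Σ; ∃; ∃-syntax; _,_)
open import Data.Sum using (_⊎_)
open import Data.Empty using (⊥)
open import Relation.Nullary using (¬_)
open import Relation.Nullary.Decidable using (⌊_⌋)
open import Relation.Binary.PropositionalEquality using (_≡_; _≢_)

Graph : ℕ → Set
Graph n = Fin n → Fin n → Bool

IsSimple : ∀ {n} → Graph n → Set
IsSimple {n} G = (∀ (x y : Fin n) → G x y ≡ G y x) × (∀ (x : Fin n) → G x x ≡ false)

Link : ∀ {n} → Graph n → Fin n → Fin n → Set
Link G u v = G u v ≡ true

SameLink : ∀ {n} → Fin n → Fin n → Fin n → Fin n → Set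
SameLink a b u v = (a ≡ u × b ≡ v) ⊎ (a ≡ v × b ≡ u)

sameLinkᵇ : ∀ {n} → Fin n → Fin n → Fin n → Fin n → Bool
sameLinkᵇ a b u v = (⌊ a ≟ u ⌋ ∧ ⌊ b ≟ v ⌋) ∨ (⌊ a ≟ v ⌋ ∧ ⌊ b ≟ u ⌋)

_∖_ : ∀ {n} → Graph n → Fin n × Fin n → Graph n
(G ∖ (u , v)) x y = G x y ∧ not (sameLinkᵇ x y u v)

-- Walks in G avoiding the set of removed nodes X (i.e. walks in G - X).
data Walk {n} (G : Graph n) (X : Fin n → Set) : Fin n → Fin n → Set where
  here : ∀ {x} → ¬ X x → Walk G X x x
  step : ∀ {x y z} → ¬ X x → G x y ≡ true → Walk G X y z → Walk G X x z

Disconnected : ∀ {n} → Graph n → (Fin n → Set) → Set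
Disconnected {n} G X = Σ (Fin n) λ x → Σ (Fin n) λ y → ¬ X x × ¬ X y × ¬ Walk G X x y

NoNode : ∀ {n} → Fin n → Set
NoNode _ = ⊥

Connected : ∀ {n} → Graph n → Set
Connected {n} G = ∀ (x y : Fin n) → Walk G NoNode x y

CutNode : ∀ {n} → Graph n → Fin n → Set
CutNode G w = Disconnected G (λ x → x ≡ w)

Biconnected : ∀ {n} → Graph n → Set
Biconnected {n} G = Connected G × (∀ (w : Fin n) → ¬ CutNode G w)

Pair : ∀ {n} → Fin n → Fin n → Fin n → Set
Pair u v x = x ≡ u ⊎ x ≡ v

Separating : ∀ {n} → Graph n → Fin n → Fin n → Set
Separating G u v = Link G u v × Disconnected G (Pair u v)

SeparatesNode : ∀ {n} → Graph n → Fin n → Fin n → Fin n → Fin n → Set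
SeparatesNode G t u v w =
  Separating G u v × ¬ Pair u v w × ¬ Pair u v t × ¬ Walk G (Pair u v) w t

SeparatesLink : ∀ {n} → Graph n → Fin n → Fin n → Fin n → Fin n → Fin n → Set
SeparatesLink G t u v a b =
  Link G a b × ¬ SameLink a b u v × (SeparatesNode G t u v a ⊎ SeparatesNode G t u v b)

InS : ∀ {n} → Graph n → Fin n → Fin n → Fin n → Fin n → Fin n → Set
InS G t u v a b = Separating G u v × t ≢ u × t ≢ v × SeparatesLink G t u v a b

{-# OPTIONS --safe #-}

-- Deleting a link only destroys walks, so f stays separating in G ∖ e, and whatever
-- e separates from t in G it still separates in G ∖ f. Conversely, deleting
-- f = {f₁,f₂} destroys no connection in G - {e₁,e₂}: if e meets f, the link f is not
-- in G - {e₁,e₂} at all; otherwise f₁ and f₂ remain joined in (G ∖ f) - {e₁,e₂},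
-- and walks are rerouted along that detour. To see the latter, let z ∉ f. By
-- biconnectivity z reaches f₂ in G - f₁ and f₁ in G - f₂; if neither walk meets e,
-- together they join f₁ to f₂ without using the link f, and otherwise z reaches e
-- in G - {f₁,f₂}. So if f₁ and f₂ were not joined, every z ∉ f would reach e in
-- G - {f₁,f₂}, contradicting that f is separating.
module Submission where

open import Defs
open import Data.Nat using (ℕ)
open import Data.Fin using (Fin; _≟_)
open import Data.Bool using (true; false; _∧_; _∨_; not)
open import Data.Product using (_×_; _,_; proj₁; ∃-syntax; map₂)
open import Data.Sum using (_⊎_; inj₁; inj₂; [_,_]′) renaming (map to ⊎-map)
open import Data.Empty using (⊥-elim)
open import Function using (_∘_; id)
open import Function.Bundles using (mk⇔)
open import Relation.Nullary using (¬_; Dec; yes; no; does)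
open import Relation.Nullary.Decidable using (_×-dec_; _⊎-dec_; dec-true; dec-false; does-⇔; isYes≗does)
open import Relation.Unary using (Decidable)
open import Relation.Binary.PropositionalEquality using (_≡_; _≢_; refl; sym; trans; cong₂; module ≡-Reasoning)

variable
  n : ℕ
  G H : Graph n
  X Y : Fin n → Set
  a b c u v w x y z : Fin n

Undirected : Graph n → Set
Undirected {n} G = ∀ (x y : Fin n) → G x y ≡ G y x

Loopless : Graph n → Set
Loopless {n} G = ∀ (x : Fin n) → G x x ≡ false

link⇒≢ : Loopless G → Link G u v → u ≢ v
link⇒≢ {u = u} loopless uv refl with trans (sym uv) (loopless u)
... | ()

Pair-swap : Pair u v x → Pair v u x
Pair-swap (inj₁ x≡u) = inj₂ x≡u
Pair-swap (inj₂ x≡v) = inj₁ x≡v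

∉Pair-comm : ¬ Pair u v a → ¬ Pair u v b → ¬ Pair a b u
∉Pair-comm a∉uv b∉uv (inj₁ u≡a) = a∉uv (inj₁ (sym u≡a))
∉Pair-comm a∉uv b∉uv (inj₂ u≡b) = b∉uv (inj₁ (sym u≡b))

pair? : (u v : Fin n) → Decidable (Pair u v)
pair? u v x = (x ≟ u) ⊎-dec (x ≟ v)

SameLink-swap : SameLink a b u v → SameLink b a u v
SameLink-swap (inj₁ (a≡u , b≡v)) = inj₂ (b≡v , a≡u)
SameLink-swap (inj₂ (a≡v , b≡u)) = inj₁ (b≡u , a≡v)

SameLink-comm : SameLink a b u v → SameLink u v a b
SameLink-comm (inj₁ (a≡u , b≡v)) = inj₁ (sym a≡u , sym b≡v)
SameLink-comm (inj₂ (a≡v , b≡u)) = inj₂ (sym b≡u , sym a≡v)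

SameLink⇒Pair : SameLink a b u v → Pair u v a
SameLink⇒Pair (inj₁ (a≡u , _)) = inj₁ a≡u
SameLink⇒Pair (inj₂ (a≡v , _)) = inj₂ a≡v

sameLink? : (a b u v : Fin n) → Dec (SameLink a b u v)
sameLink? a b u v = ((a ≟ u) ×-dec (b ≟ v)) ⊎-dec ((a ≟ v) ×-dec (b ≟ u))

sameLinkᵇ≡does : (a b u v : Fin n) → sameLinkᵇ a b u v ≡ does (sameLink? a b u v)
sameLinkᵇ≡does a b u v =
  cong₂ _∨_ (cong₂ _∧_ (isYes≗does (a ≟ u)) (isYes≗does (b ≟ v)))
            (cong₂ _∧_ (isYes≗does (a ≟ v)) (isYes≗does (b ≟ u)))

sameLinkᵇ-true : SameLink a b u v → sameLinkᵇ a b u v ≡ true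
sameLinkᵇ-true {a = a} {b} {u} {v} ab≡uv =
  trans (sameLinkᵇ≡does a b u v) (dec-true (sameLink? a b u v) ab≡uv)

sameLinkᵇ-false : ¬ SameLink a b u v → sameLinkᵇ a b u v ≡ false
sameLinkᵇ-false {a = a} {b} {u} {v} ab≢uv =
  trans (sameLinkᵇ≡does a b u v) (dec-false (sameLink? a b u v) ab≢uv)

sameLinkᵇ-swap : (a b u v : Fin n) → sameLinkᵇ a b u v ≡ sameLinkᵇ b a u v
sameLinkᵇ-swap a b u v = begin
  sameLinkᵇ a b u v          ≡⟨ sameLinkᵇ≡does a b u v ⟩
  does (sameLink? a b u v)   ≡⟨ does-⇔ (mk⇔ SameLink-swap SameLink-swap) (sameLink? a b u v) (sameLink? b a u v) ⟩
  does (sameLink? b a u v)   ≡⟨ sameLinkᵇ≡does b a u v ⟨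
  sameLinkᵇ b a u v          ∎
  where open ≡-Reasoning

∖-link : ¬ SameLink a b u v → Link G a b → Link (G ∖ (u , v)) a b
∖-link ab≢uv ab rewrite ab | sameLinkᵇ-false ab≢uv = refl

∖-⊆ : Link (G ∖ (u , v)) a b → Link G a b
∖-⊆ {G = G} {a = a} {b} ab with G a b
... | true = refl
... | false = ab

∖-removes : Link (G ∖ (u , v)) a b → ¬ SameLink a b u v
∖-removes {G = G} {u = u} {v} {a} {b} ab ab≡uv
  with G a b | sameLinkᵇ a b u v | sameLinkᵇ-true ab≡uv
∖-removes () _ | true | .true | refl
∖-removes () _ | false | _ | _

∖-undirected : Undirected G → Undirected (G ∖ (u , v))
∖-undirected {u = u} {v} G-sym x y =
  cong₂ (λ xy xy≡uv → xy ∧ not xy≡uv) (G-sym x y) (sameLinkᵇ-swap x y u v)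

source-∉ : Walk G X x y → ¬ X x
source-∉ (here x∉X) = x∉X
source-∉ (step x∉X _ _) = x∉X

_++ʷ_ : Walk G X x y → Walk G X y z → Walk G X x z
here _ ++ʷ yz = yz
step x∉X xx′ x′y ++ʷ yz = step x∉X xx′ (x′y ++ʷ yz)

reverse : Undirected G → Walk G X x y → Walk G X y x
reverse G-sym (here x∉X) = here x∉X
reverse G-sym (step x∉X xx′ x′y) =
  reverse G-sym x′y ++ʷ step (source-∉ x′y) (trans (G-sym _ _) xx′) (here x∉X)

Walk-map : (∀ {x y} → Link G x y → Link H x y) → (∀ {x} → Y x → X x) →
           Walk G X x y → Walk H Y x y
Walk-map G⊆H Y⊆X (here x∉X) = here (x∉X ∘ Y⊆X)
Walk-map G⊆H Y⊆X (step x∉X xx′ x′y) = step (x∉X ∘ Y⊆X) (G⊆H xx′) (Walk-map G⊆H Y⊆X x′y)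

¬Walk-⊆ : (∀ {x y} → Link H x y → Link G x y) → ¬ Walk G X x y → ¬ Walk H X x y
¬Walk-⊆ H⊆G ¬xy xy = ¬xy (Walk-map H⊆G id xy)

-- The walk is cut at its first node in X or at b; before that it only leaves
-- nodes outside {a, b}, so it survives in any H keeping those links.
walk-until : Decidable X → ¬ X b →
             (∀ {x y} → ¬ Pair a b x → Link G x y → Link H x y) →
             Walk G (_≡ a) z b → (∃[ x ] X x × Walk G (Pair a b) z x) ⊎ Walk H X z b
walk-until X? b∉X G⊆H (here _) = inj₂ (here b∉X)
walk-until {b = b} X? b∉X G⊆H (step {x = z} z≢a zz′ z′b) with z ≟ b | X? z
... | yes refl | _ = inj₂ (here b∉X)
... | no z≢b | yes z∈X = inj₁ (z , z∈X , here [ z≢a , z≢b ]′)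
... | no z≢b | no z∉X =
  ⊎-map (map₂ (map₂ (step [ z≢a , z≢b ]′ zz′)))
        (step z∉X (G⊆H [ z≢a , z≢b ]′ zz′))
        (walk-until X? b∉X G⊆H z′b)

reroute : Undirected G → (¬ X u → ¬ X v → Walk (G ∖ (u , v)) X u v) →
          Walk G X x y → Walk (G ∖ (u , v)) X x y
reroute G-sym uv (here x∉X) = here x∉X
reroute {G = G} {u = u} {v = v} G-sym uv (step {x = x} {y = x′} x∉X xx′ x′y) with sameLink? x x′ u v
... | no xx′≢uv = step x∉X (∖-link {G = G} xx′≢uv xx′) (reroute G-sym uv x′y)
... | yes (inj₁ (refl , refl)) = uv x∉X (source-∉ x′y) ++ʷ reroute G-sym uv x′y
... | yes (inj₂ (refl , refl)) =
  reverse (∖-undirected G-sym) (uv (source-∉ x′y) x∉X) ++ʷ reroute G-sym uv x′y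

¬¬Walk-avoiding : Biconnected G → x ≢ w → y ≢ w → ¬ ¬ Walk G (_≡ w) x y
¬¬Walk-avoiding (_ , no-cut-node) x≢w y≢w ¬xy = no-cut-node _ (_ , _ , x≢w , y≢w , ¬xy)

common-target⇒¬Disconnected : Undirected G → (∀ {z} → ¬ X z → ¬ ¬ Walk G X z c) →
                              ¬ Disconnected G X
common-target⇒¬Disconnected G-sym reaches (x , y , x∉X , y∉X , ¬xy) =
  reaches x∉X λ xc → reaches y∉X λ yc → ¬xy (xc ++ʷ reverse G-sym yc)

separator-endpoints-¬¬connected :
  Undirected G → Biconnected G → u ≢ v → Disconnected G (Pair u v) → Link G a b →
  ¬ Pair a b u → ¬ Pair a b v → ¬ ¬ Walk (G ∖ (u , v)) (Pair a b) u v
separator-endpoints-¬¬connected {G = G} {u = u} {v} {a} {b}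
  G-sym biconnected u≢v disconnected ab u∉ab v∉ab ¬uv =
  common-target⇒¬Disconnected G-sym reaches-a disconnected
  where
  ab-reaches-a : Pair a b x → Walk G (Pair u v) x a
  ab-reaches-a (inj₁ refl) = here (∉Pair-comm u∉ab v∉ab)
  ab-reaches-a (inj₂ refl) =
    step (∉Pair-comm (u∉ab ∘ Pair-swap) (v∉ab ∘ Pair-swap)) (trans (G-sym _ _) ab)
         (here (∉Pair-comm u∉ab v∉ab))

  reaches-a-via : Walk G (_≡ u) z v → Walk G (_≡ v) z u → Walk G (Pair u v) z a
  reaches-a-via zv zu
    with walk-until (pair? a b) v∉ab (λ x∉uv → ∖-link {G = G} (x∉uv ∘ SameLink⇒Pair)) zv
       | walk-until (pair? a b) u∉ab (λ x∉vu → ∖-link {G = G} (x∉vu ∘ Pair-swap ∘ SameLink⇒Pair)) zu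
  ... | inj₁ (x , x∈ab , zx) | _ = zx ++ʷ ab-reaches-a x∈ab
  ... | inj₂ _ | inj₁ (x , x∈ab , zx) = Walk-map id Pair-swap zx ++ʷ ab-reaches-a x∈ab
  ... | inj₂ zv′ | inj₂ zu′ = ⊥-elim (¬uv (reverse (∖-undirected G-sym) zu′ ++ʷ zv′))

  reaches-a : ¬ Pair u v z → ¬ ¬ Walk G (Pair u v) z a
  reaches-a z∉uv ¬za =
    ¬¬Walk-avoiding biconnected (z∉uv ∘ inj₁) (u≢v ∘ sym) λ zv →
    ¬¬Walk-avoiding biconnected (z∉uv ∘ inj₂) u≢v λ zu →
    ¬za (reaches-a-via zv zu)

¬Walk-∖⇒¬Walk :
  Undirected G → Biconnected G → u ≢ v → Disconnected G (Pair u v) → Link G a b →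
  ¬ Walk (G ∖ (u , v)) (Pair a b) x y → ¬ Walk G (Pair a b) x y
¬Walk-∖⇒¬Walk {u = u} {v} {a} {b} G-sym biconnected u≢v disconnected ab ¬xy′ xy
  with pair? a b u ⊎-dec pair? a b v
... | yes uv∩ab = ¬xy′ (reroute G-sym (λ u∉ab v∉ab → ⊥-elim ([ u∉ab , v∉ab ]′ uv∩ab)) xy)
... | no uv∩ab≡∅ =
  separator-endpoints-¬¬connected G-sym biconnected u≢v disconnected ab
    (uv∩ab≡∅ ∘ inj₁) (uv∩ab≡∅ ∘ inj₂) (λ uv → ¬xy′ (reroute G-sym (λ _ _ → uv) xy))

Separating-transfer : Link H u v →
                      (∀ {x y} → ¬ Walk G (Pair u v) x y → ¬ Walk H (Pair u v) x y) →
                      Separating G u v → Separating H u v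
Separating-transfer uv ¬walk⇒ (_ , (x , y , x∉uv , y∉uv , ¬xy)) =
  uv , (x , y , x∉uv , y∉uv , ¬walk⇒ ¬xy)

InS-link : ∀ {t} → InS G t u v a b → Link G a b
InS-link (_ , _ , _ , ab , _) = ab

InS-transfer : ∀ {t} → Separating H u v →
               (∀ {x y} → ¬ Walk G (Pair u v) x y → ¬ Walk H (Pair u v) x y) →
               (Link G a b → Link H a b) → InS G t u v a b → InS H t u v a b
InS-transfer {H = H} {u = u} {v = v} {G = G} {t = t} sep ¬walk⇒ link⇒
  (_ , t≢u , t≢v , ab , ab≢uv , separated) =
  sep , t≢u , t≢v , link⇒ ab , ab≢uv , ⊎-map node node separated
  where
  node : SeparatesNode G t u v w → SeparatesNode H t u v w
  node (_ , w∉uv , t∉uv , ¬wt) = sep , w∉uv , t∉uv , ¬walk⇒ ¬wt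

lemma6p9 : (n : ℕ) (G : Graph n) (t : Fin n) → IsSimple G → Biconnected G →
    (f₁ f₂ e₁ e₂ : Fin n) → Separating G f₁ f₂ → Link G e₁ e₂ → ¬ SameLink e₁ e₂ f₁ f₂ →
    Separating (G ∖ (e₁ , e₂)) f₁ f₂ ×
    (Separating (G ∖ (f₁ , f₂)) e₁ e₂ →
      Separating G e₁ e₂ ×
      ((a b : Fin n) →
        (InS (G ∖ (f₁ , f₂)) t e₁ e₂ a b → InS G t e₁ e₂ a b × ¬ SameLink a b f₁ f₂) ×
        (InS G t e₁ e₂ a b × ¬ SameLink a b f₁ f₂ → InS (G ∖ (f₁ , f₂)) t e₁ e₂ a b)))
lemma6p9 n G t (G-sym , loopless) biconnected f₁ f₂ e₁ e₂ f-sep@(f , f-disconnected) e e≢f =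
  Separating-transfer (∖-link {G = G} (e≢f ∘ SameLink-comm) f) (¬Walk-⊆ (∖-⊆ {G = G})) f-sep ,
  λ e-sep′ →
    let e-sep = Separating-transfer (∖-⊆ {G = G} (proj₁ e-sep′)) ¬Walk-∖f⇒¬Walk e-sep′
    in e-sep , λ a b →
         (λ ab∈S′ → InS-transfer e-sep ¬Walk-∖f⇒¬Walk (∖-⊆ {G = G}) ab∈S′ ,
                    ∖-removes {G = G} (InS-link ab∈S′)) ,
         (λ (ab∈S , ab≢f) → InS-transfer e-sep′ (¬Walk-⊆ (∖-⊆ {G = G})) (∖-link {G = G} ab≢f) ab∈S)
  where
  ¬Walk-∖f⇒¬Walk : ∀ {x y} → ¬ Walk (G ∖ (f₁ , f₂)) (Pair e₁ e₂) x y → ¬ Walk G (Pair e₁ e₂) x y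
  ¬Walk-∖f⇒¬Walk = ¬Walk-∖⇒¬Walk G-sym biconnected (link⇒≢ loopless f) f-disconnected e
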